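{- Let $\mathcal{F}$ be a union-closed family, let $A \in \mathcal{F}$ be a minimal non-empty set of $\mathcal{F}$ (i.e., $A \neq \emptyset$ and no non-empty $B \in \mathcal{F}$ satisfies $B \subsetneq A$), and let $\mathcal{G} := \mathcal{F} \setminus \{A\}$. If there exist $a,b \in \bigcup \mathcal{G}$ such that $\mathcal{G}_a = \mathcal{G}_b$ but $\mathcal{F}_a \neq \mathcal{F}_b$, then either $a \in B$ for all non-empty $B \in \mathcal{F}$, or $b \in B$ for all non-empty $B \in \mathcal{F}$.
   Context: A union-closed family is a finite family $\mathcal{F}$ of finite sets such that $A \cup B \in \mathcal{F}$ for all $A, B \in \mathcal{F}$. For a family of sets $\mathcal{H}$, $\bigcup \mathcal{H} := \bigcup_{A \in \mathcal{H}} A$, and for an element $x$, $\mathcal{H}_x := \{S \in \mathcal{H} : x \in S\}$. -}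

module Defs where

open import Data.Nat using (ℕ)
open import Data.Fin using (Fin)
open import Data.Fin.Subset using (Subset; _∪_; _⊆_; Nonempty) renaming (_∈_ to _∈ₛ_)
open import Data.List using (List)
open import Data.List.Membership.Propositional using () renaming (_∈_ to _∈ₗ_)
open import Data.Product using (Σ; _×_; ∃)
open import Relation.Binary.PropositionalEquality using (_≡_; _≢_)
open import Relation.Nullary using (¬_)
open import Function.Bundles using (_⇔_)

-- Ground set: WLOG Fin n (all sets of a finite family live in a finite union).
-- A finite family of finite sets: a list of subsets; membership is list membership
-- (duplicates are irrelevant, all notions below depend only on membership).
Family : ℕ → Set
Family n = List (Subset n)

_∈𝓕_ : ∀ {n} → Subset n → Family n → Set
S ∈𝓕 𝓕 = S ∈ₗ 𝓕

UnionClosed : ∀ {n} → Family n → Set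
UnionClosed 𝓕 = ∀ A B → A ∈𝓕 𝓕 → B ∈𝓕 𝓕 → (A ∪ B) ∈𝓕 𝓕

MinimalNonempty : ∀ {n} → Family n → Subset n → Set
MinimalNonempty 𝓕 A =
  A ∈𝓕 𝓕 × Nonempty A ×
  (∀ B → ¬ (B ∈𝓕 𝓕 × Nonempty B × B ⊆ A × B ≢ A))

_∖[_] : ∀ {n} → Family n → Subset n → Subset n → Set
(𝓕 ∖[ A ]) S = S ∈𝓕 𝓕 × S ≢ A

_∈⋃_ : ∀ {n} → Fin n → (Subset n → Set) → Set
x ∈⋃ 𝓗 = ∃ λ S → 𝓗 S × x ∈ₛ S

SameStar : ∀ {n} → (Subset n → Set) → Fin n → Fin n → Set
SameStar 𝓗 x y = ∀ S → (𝓗 S × x ∈ₛ S) ⇔ (𝓗 S × y ∈ₛ S)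

mem : ∀ {n} → Family n → Subset n → Set
mem 𝓕 S = S ∈𝓕 𝓕

-- Removing A from 𝓕 changes the stars of a and b only at A itself, so A separates a and b,
-- say a ∈ A and b ∉ A. Then a lies in every non-empty B ≠ A of 𝓕: by minimality of A the
-- union B ∪ A is a set of 𝓖 containing a, hence b; as b ∉ A we get b ∈ B, and 𝓖_a = 𝓖_b
-- puts a in B.
module Submission where

open import Defs
open import Data.Nat using (ℕ)
open import Data.Fin using (Fin)
open import Data.Fin.Subset using (Subset; Nonempty; _∪_; _∉_) renaming (_∈_ to _∈ₛ_)
open import Data.Fin.Subset.Properties using (_∈?_; p⊆p∪q; q⊆p∪q; x∈p∪q⁻)
open import Data.Bool.Properties using () renaming (_≟_ to _≟ᵇ_)
open import Data.Vec.Properties using (≡-dec)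
open import Data.Product using (_×_; _,_; proj₁; proj₂)
open import Data.Sum using (_⊎_; inj₁; inj₂)
open import Relation.Nullary using (¬_; Dec; yes; no; contradiction)
open import Relation.Binary.PropositionalEquality using (_≡_; _≢_; refl; subst)
open import Function.Bundles using (_⇔_; mk⇔; Equivalence)
open import Function.Properties.Equivalence using () renaming (sym to ⇔-sym)

private
  variable
    n : ℕ
    𝓕 : Family n
    A : Subset n
    x y : Fin n

_≟ₛ_ : (S T : Subset n) → Dec (S ≡ T)
_≟ₛ_ = ≡-dec _≟ᵇ_

SameStar-sym : {𝓗 : Subset n → Set} → SameStar 𝓗 x y → SameStar 𝓗 y x
SameStar-sym st S = ⇔-sym (st S)

star-⊆-insert : (x ∈ₛ A → y ∈ₛ A) → SameStar (𝓕 ∖[ A ]) x y →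
                ∀ S → mem 𝓕 S × x ∈ₛ S → mem 𝓕 S × y ∈ₛ S
star-⊆-insert {A = A} x∈A⇒y∈A st S (S∈𝓕 , x∈S) with S ≟ₛ A
... | yes refl = S∈𝓕 , x∈A⇒y∈A x∈S
... | no S≢A   = S∈𝓕 , proj₂ (Equivalence.to (st S) ((S∈𝓕 , S≢A) , x∈S))

SameStar-insert : (x ∈ₛ A ⇔ y ∈ₛ A) → SameStar (𝓕 ∖[ A ]) x y → SameStar (mem 𝓕) x y
SameStar-insert x∈A⇔y∈A st S =
  mk⇔ (star-⊆-insert (Equivalence.to x∈A⇔y∈A) st S)
      (star-⊆-insert (Equivalence.from x∈A⇔y∈A) (SameStar-sym st) S)

separated-by-removed : SameStar (𝓕 ∖[ A ]) x y → ¬ SameStar (mem 𝓕) x y →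
                       (x ∈ₛ A × y ∉ A) ⊎ (y ∈ₛ A × x ∉ A)
separated-by-removed {A = A} {x = x} {y = y} st ¬st with x ∈? A | y ∈? A
... | yes x∈A | no y∉A  = inj₁ (x∈A , y∉A)
... | no x∉A  | yes y∈A = inj₂ (y∈A , x∉A)
... | yes x∈A | yes y∈A =
  contradiction (SameStar-insert (mk⇔ (λ _ → y∈A) (λ _ → x∈A)) st) ¬st
... | no x∉A  | no y∉A  =
  contradiction (SameStar-insert (mk⇔ (λ x∈A → contradiction x∈A x∉A)
                                      (λ y∈A → contradiction y∈A y∉A)) st) ¬st

∪-minimalNonempty-≢ : MinimalNonempty 𝓕 A → ∀ B → B ∈𝓕 𝓕 → Nonempty B → B ≢ A → B ∪ A ≢ A
∪-minimalNonempty-≢ {A = A} (_ , _ , minimal) B B∈𝓕 B≠∅ B≢A B∪A≡A =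
  minimal B (B∈𝓕 , B≠∅ , (λ {z} z∈B → subst (z ∈ₛ_) B∪A≡A (p⊆p∪q A z∈B)) , B≢A)

∈-every-nonempty : UnionClosed 𝓕 → MinimalNonempty 𝓕 A → SameStar (𝓕 ∖[ A ]) x y →
                   x ∈ₛ A → y ∉ A → ∀ B → B ∈𝓕 𝓕 → Nonempty B → x ∈ₛ B
∈-every-nonempty {𝓕 = 𝓕} {A = A} {y = y} closed minA st x∈A y∉A B B∈𝓕 B≠∅ with B ≟ₛ A
... | yes refl = x∈A
... | no B≢A   = proj₂ (Equivalence.from (st B) ((B∈𝓕 , B≢A) , y∈B))
  where
  B∪A∈𝓖 : (𝓕 ∖[ A ]) (B ∪ A)
  B∪A∈𝓖 = closed B A B∈𝓕 (proj₁ minA) , ∪-minimalNonempty-≢ minA B B∈𝓕 B≠∅ B≢A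

  y∈B∪A : y ∈ₛ B ∪ A
  y∈B∪A = proj₂ (Equivalence.to (st (B ∪ A)) (B∪A∈𝓖 , q⊆p∪q B A x∈A))

  y∈B : y ∈ₛ B
  y∈B with x∈p∪q⁻ B A y∈B∪A
  ... | inj₁ y∈B = y∈B
  ... | inj₂ y∈A = contradiction y∈A y∉A

lemma1 : ∀ {n} (𝓕 : Family n) (A : Subset n) (a b : Fin n) →
    UnionClosed 𝓕 →
    MinimalNonempty 𝓕 A →
    a ∈⋃ (𝓕 ∖[ A ]) → b ∈⋃ (𝓕 ∖[ A ]) →
    SameStar (𝓕 ∖[ A ]) a b →
    ¬ SameStar (mem 𝓕) a b →
    (∀ B → B ∈𝓕 𝓕 → Nonempty B → a ∈ₛ B) ⊎ (∀ B → B ∈𝓕 𝓕 → Nonempty B → b ∈ₛ B)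
lemma1 𝓕 A a b closed minA _ _ st ¬st with separated-by-removed st ¬st
... | inj₁ (a∈A , b∉A) = inj₁ (∈-every-nonempty closed minA st a∈A b∉A)
... | inj₂ (b∈A , a∉A) = inj₂ (∈-every-nonempty closed minA (SameStar-sym st) b∈A a∉A)
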